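{- Let $s_1,t_1$ be $\mathcal{L}_{BT}$-terms. There exist $\mathcal{L}_{BT}$-terms $s,t$ and variables $v_1,\ldots,v_k$ such that $\mathfrak{B}\models\neg(s_1\sqsubseteq t_1)\leftrightarrow(\forall v_1\sqsubseteq t_1)\exists v_2\ldots v_k[s=t]$.
   Context: Bit strings are elements of $\{\mathbf{0},\mathbf{1}\}^*$; $\varepsilon$ is the empty string. The language $\mathcal{L}_{BT}$ has constant symbols $e,0,1$, binary function symbol $\circ$, and binary relation symbol $\sqsubseteq$; terms are built from variables and $e,0,1$ with $\circ$. The structure $\mathfrak{B}$ has universe $\{\mathbf{0},\mathbf{1}\}^*$, interprets $e,0,1$ as $\varepsilon,\mathbf{0},\mathbf{1}$, $\circ$ as concatenation, and $\sqsubseteq$ as the substring relation ($\alpha\sqsubseteq\beta$ iff $\gamma\alpha\delta=\beta$ for some $\gamma,\delta$). $(\forall v\sqsubseteq t)\phi$ abbreviates $\forall v[v\sqsubseteq t\to\phi]$. A formula with free variables holds in $\mathfrak{B}$ if it holds under every assignment. -}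

module Defs where

open import Data.Nat using (ℕ; _≟_)
open import Data.Bool using (Bool)
open import Data.List using (List; []; _∷_; _++_)
open import Data.Product using (Σ; ∃; _×_; _,_)
open import Data.Empty using (⊥)
open import Relation.Nullary using (¬_; yes; no)
open import Relation.Binary.PropositionalEquality using (_≡_)

Var : Set
Var = ℕ

data Term : Set where
  var  : Var → Term
  e    : Term
  c0   : Term
  c1   : Term
  _∘_  : Term → Term → Term

data Formula : Set where
  _≐_   : Term → Term → Formula
  _⊑ᶠ_  : Term → Term → Formula
  ¬ᶠ_   : Formula → Formula
  _⇒_   : Formula → Formula → Formula
  _⇔_   : Formula → Formula → Formula
  ∀ᶠ    : Var → Formula → Formula
  ∃ᶠ    : Var → Formula → Formula

∀⊑ : Var → Term → Formula → Formula
∀⊑ v t φ = ∀ᶠ v ((var v ⊑ᶠ t) ⇒ φ)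

∃* : List Var → Formula → Formula
∃* []       φ = φ
∃* (v ∷ vs) φ = ∃ᶠ v (∃* vs φ)

-- The structure 𝔅: bit strings are lists of booleans (false = 𝟎, true = 𝟏).
BitString : Set
BitString = List Bool

Assignment : Set
Assignment = Var → BitString

update : Assignment → Var → BitString → Assignment
update ρ v a w with w ≟ v
... | yes _ = a
... | no  _ = ρ w

⟦_⟧ₜ : Term → Assignment → BitString
⟦ var v ⟧ₜ ρ = ρ v
⟦ e ⟧ₜ     ρ = []
⟦ c0 ⟧ₜ    ρ = Bool.false ∷ []
⟦ c1 ⟧ₜ    ρ = Bool.true ∷ []
⟦ s ∘ t ⟧ₜ ρ = ⟦ s ⟧ₜ ρ ++ ⟦ t ⟧ₜ ρ

_⊑_ : BitString → BitString → Set
α ⊑ β = Σ BitString λ γ → Σ BitString λ δ → γ ++ (α ++ δ) ≡ β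

_⊨_ : Assignment → Formula → Set
ρ ⊨ (s ≐ t)   = ⟦ s ⟧ₜ ρ ≡ ⟦ t ⟧ₜ ρ
ρ ⊨ (s ⊑ᶠ t)  = ⟦ s ⟧ₜ ρ ⊑ ⟦ t ⟧ₜ ρ
ρ ⊨ (¬ᶠ φ)    = ¬ (ρ ⊨ φ)
ρ ⊨ (φ ⇒ ψ)   = ρ ⊨ φ → ρ ⊨ ψ
ρ ⊨ (φ ⇔ ψ)   = (ρ ⊨ φ → ρ ⊨ ψ) × (ρ ⊨ ψ → ρ ⊨ φ)
ρ ⊨ (∀ᶠ v φ)  = (a : BitString) → update ρ v a ⊨ φ
ρ ⊨ (∃ᶠ v φ)  = Σ BitString λ a → update ρ v a ⊨ φ

𝔅⊨ : Formula → Set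
𝔅⊨ φ = (ρ : Assignment) → ρ ⊨ φ

-- ¬ (s₁ ⊑ t₁) says that every substring v of t₁ differs from s₁, so it suffices to express u ≢ v
-- by an existential equation. After padding both strings by a suitable bit, distinct u and v
-- disagree at a common position: u pad = p c x and v pad = p d y with c, d complementary letters.
-- That c, d are complementary letters says exactly that c d d c is a conjugate of 0110
-- (c d d c = P Q and Q P = 0110). Finally, two equations s = t and s′ = t′ are equivalent to the
-- single equation s 0 s′ s 1 s′ = t 0 t′ t 1 t′, since both sides split into halves of equal length.
module Submission where

open import Defs
open import Data.Bool using (Bool; true; false; not)
open import Data.Bool.Properties using (not-¬; ¬-not; not-involutive)
import Data.Bool.Properties as Bool
open import Data.List using (List; []; _∷_; _++_; [_]; length; applyUpTo)
open import Data.List.Properties using (∷-injective; ∷-injectiveˡ; ∷-injectiveʳ; ++-assoc; ++-cancelˡ; length-++)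
open import Data.List.Membership.Propositional using (_∈_; _∉_)
open import Data.List.Membership.Propositional.Properties using (∈-applyUpTo⁺; ∈-applyUpTo⁻)
open import Data.List.Relation.Unary.Any using (here; there)
open import Data.Nat using (ℕ; zero; suc; _+_; _∸_; _⊔_; _<_; _≤_; s≤s)
open import Data.Nat.Properties
  using (_≟_; suc-injective; +-suc; +-comm; +-assoc; m+n∸n≡m; m≤n+m; m≤m⊔n; m≤n⊔m; <-≤-trans; <⇒≢; <⇒≱; <⇒≤; ≤-refl)
open import Data.List.Membership.DecPropositional _≟_ using (_∈?_)
open import Data.Product using (Σ; _×_; _,_; proj₁; proj₂; uncurry)
open import Relation.Binary.PropositionalEquality
  using (_≡_; _≢_; ≢-sym; _≗_; refl; sym; trans; cong; cong₂; subst₂; module ≡-Reasoning)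
open import Relation.Nullary using (yes; no; contradiction)

m+m≡n+n⇒m≡n : ∀ m n → m + m ≡ n + n → m ≡ n
m+m≡n+n⇒m≡n zero    zero    _  = refl
m+m≡n+n⇒m≡n (suc m) (suc n) eq rewrite +-suc m m | +-suc n n =
  cong suc (m+m≡n+n⇒m≡n m n (suc-injective (suc-injective eq)))

++-cancel-length : ∀ {A : Set} (xs ys : List A) {zs ws} →
  length xs ≡ length ys → xs ++ zs ≡ ys ++ ws → xs ≡ ys × zs ≡ ws
++-cancel-length []       []       _ eq = refl , eq
++-cancel-length (x ∷ xs) (y ∷ ys) l eq with ∷-injective eq
... | refl , eq′ with ++-cancel-length xs ys (suc-injective l) eq′
...   | refl , zs≡ws = refl , zs≡ws

halves-injective : ∀ {A : Set} {xs xs′ ys ys′ : List A} →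
  length xs ≡ length xs′ → length ys ≡ length ys′ →
  xs ++ xs′ ≡ ys ++ ys′ → xs ≡ ys × xs′ ≡ ys′
halves-injective {xs = xs} {xs′} {ys} {ys′} ∣xs∣≡∣xs′∣ ∣ys∣≡∣ys′∣ eq =
  ++-cancel-length xs ys (m+m≡n+n⇒m≡n _ _ lengths) eq
  where
  open ≡-Reasoning
  lengths : length xs + length xs ≡ length ys + length ys
  lengths = begin
    length xs + length xs  ≡⟨ cong (length xs +_) ∣xs∣≡∣xs′∣ ⟩
    length xs + length xs′ ≡⟨ length-++ xs ⟨
    length (xs ++ xs′)     ≡⟨ cong length eq ⟩
    length (ys ++ ys′)     ≡⟨ length-++ ys ⟩
    length ys + length ys′ ≡⟨ cong (length ys +_) ∣ys∣≡∣ys′∣ ⟨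
    length ys + length ys  ∎

length-middle-irrelevant : ∀ {A : Set} (xs : List A) {x y} ys →
  length (xs ++ x ∷ ys) ≡ length (xs ++ y ∷ ys)
length-middle-irrelevant xs ys = trans (length-++ xs) (sym (length-++ xs))

false-true-separate : ∀ xs ys {xs′ ys′} →
  xs ++ false ∷ xs′ ≡ ys ++ false ∷ ys′ → xs ++ true ∷ xs′ ≡ ys ++ true ∷ ys′ →
  xs ≡ ys × xs′ ≡ ys′
false-true-separate []       []       eq₀ _   = refl , ∷-injectiveʳ eq₀
false-true-separate []       (y ∷ ys) eq₀ eq₁ with ∷-injectiveˡ eq₀ | ∷-injectiveˡ eq₁
... | refl | ()
false-true-separate (x ∷ xs) []       eq₀ eq₁ with ∷-injectiveˡ eq₀ | ∷-injectiveˡ eq₁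
... | refl | ()
false-true-separate (x ∷ xs) (y ∷ ys) eq₀ eq₁ with ∷-injective eq₀
... | refl , eq₀′ with false-true-separate xs ys eq₀′ (∷-injectiveʳ eq₁)
...   | refl , xs′≡ys′ = refl , xs′≡ys′

pair : BitString → BitString → BitString
pair xs ys = xs ++ false ∷ ys ++ xs ++ true ∷ ys

pair-injective : ∀ {xs ys xs′ ys′} → pair xs ys ≡ pair xs′ ys′ → xs ≡ xs′ × ys ≡ ys′
pair-injective {xs} {ys} {xs′} {ys′} eq =
  uncurry (false-true-separate xs xs′)
    (halves-injective (length-middle-irrelevant xs {false} {true} ys)
                      (length-middle-irrelevant xs′ {false} {true} ys′)
      (trans (++-assoc xs _ _) (trans eq (sym (++-assoc xs′ _ _)))))

Conjugate : BitString → BitString → Set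
Conjugate u v = Σ BitString λ P → Σ BitString λ Q → u ≡ P ++ Q × v ≡ Q ++ P

thueMorse₄ : BitString
thueMorse₄ = false ∷ true ∷ true ∷ false ∷ []

data Rotation₀₁₁₀ : BitString → Set where
  r0110 : Rotation₀₁₁₀ (false ∷ true ∷ true ∷ false ∷ [])
  r1100 : Rotation₀₁₁₀ (true ∷ true ∷ false ∷ false ∷ [])
  r1001 : Rotation₀₁₁₀ (true ∷ false ∷ false ∷ true ∷ [])
  r0011 : Rotation₀₁₁₀ (false ∷ false ∷ true ∷ true ∷ [])

length-rotation : ∀ {w} → Rotation₀₁₁₀ w → length w ≡ 4
length-rotation r0110 = refl
length-rotation r1100 = refl
length-rotation r1001 = refl
length-rotation r0011 = refl

conjugate⇒rotation : ∀ {w} → Conjugate w thueMorse₄ → Rotation₀₁₁₀ w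
conjugate⇒rotation (_  , []                                 , refl , refl) = r0110
conjugate⇒rotation (_  , false ∷ []                         , refl , refl) = r1100
conjugate⇒rotation (_  , false ∷ true ∷ []                  , refl , refl) = r1001
conjugate⇒rotation (_  , false ∷ true ∷ true ∷ []           , refl , refl) = r0011
conjugate⇒rotation ([] , false ∷ true ∷ true ∷ false ∷ []   , refl , refl) = r0110

length-cddc : ∀ (c d : BitString) →
  length (c ++ d ++ d ++ c) ≡ (length c + length d) + (length c + length d)
length-cddc c d = begin
  length (c ++ d ++ d ++ c)                 ≡⟨ length-++ c ⟩
  length c + length (d ++ d ++ c)           ≡⟨ cong (length c +_) (length-++ d) ⟩
  length c + (length d + length (d ++ c))   ≡⟨ cong (λ n → length c + (length d + n)) (length-++ d) ⟩
  length c + (length d + (length d + length c)) ≡⟨ cong (λ n → length c + (length d + n)) (+-comm (length d) (length c)) ⟩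
  length c + (length d + (length c + length d)) ≡⟨ +-assoc (length c) (length d) _ ⟨
  (length c + length d) + (length c + length d) ∎
  where open ≡-Reasoning

rotation⇒letters : ∀ c d → length c + length d ≡ 2 → Rotation₀₁₁₀ (c ++ d ++ d ++ c) →
  Σ Bool λ b → c ≡ [ b ] × d ≡ [ not b ]
rotation⇒letters (_ ∷ []) (_ ∷ []) _ r0110 = false , refl , refl
rotation⇒letters (_ ∷ []) (_ ∷ []) _ r1001 = true , refl , refl
rotation⇒letters [] (_ ∷ _ ∷ []) _ ()
rotation⇒letters (_ ∷ _ ∷ []) [] _ ()

complementary-letters : ∀ {c d} → Conjugate (c ++ d ++ d ++ c) thueMorse₄ →
  Σ Bool λ b → c ≡ [ b ] × d ≡ [ not b ]
complementary-letters {c} {d} conj = rotation⇒letters c d (m+m≡n+n⇒m≡n _ 2 lengths) rot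
  where
  rot = conjugate⇒rotation conj
  lengths = trans (sym (length-cddc c d)) (length-rotation rot)

letters-conjugate : ∀ b → Conjugate (b ∷ not b ∷ not b ∷ b ∷ []) thueMorse₄
letters-conjugate false = [] , thueMorse₄ , refl , refl
letters-conjugate true  = true ∷ false ∷ [] , false ∷ true ∷ [] , refl , refl

record Mismatch (u v : BitString) : Set where
  constructor mismatch
  field
    prefix            : BitString
    bit               : Bool
    suffix₁ suffix₂   : BitString
    u-split           : u ≡ prefix ++ bit ∷ suffix₁
    v-split           : v ≡ prefix ++ not bit ∷ suffix₂

mismatch⇒≢ : ∀ {u v} → Mismatch u v → u ≢ v
mismatch⇒≢ (mismatch p b _ _ refl refl) eq = not-¬ refl (∷-injectiveˡ (++-cancelˡ p _ _ eq))

mismatch-∷ : ∀ {u v} b → Mismatch u v → Mismatch (b ∷ u) (b ∷ v)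
mismatch-∷ b (mismatch p c x y refl refl) = mismatch (b ∷ p) c x y refl refl

≢⇒padded-mismatch : ∀ u v → u ≢ v → Σ Bool λ pad → Mismatch (u ++ [ pad ]) (v ++ [ pad ])
≢⇒padded-mismatch [] [] u≢v = contradiction refl u≢v
≢⇒padded-mismatch [] (b ∷ v) _ =
  not b , mismatch [] (not b) [] (v ++ [ not b ]) refl (cong (_∷ v ++ [ not b ]) (sym (not-involutive b)))
≢⇒padded-mismatch (b ∷ u) [] _ = not b , mismatch [] b (u ++ [ not b ]) [] refl refl
≢⇒padded-mismatch (b ∷ u) (b′ ∷ v) bu≢b′v with b Bool.≟ b′
... | yes refl = let pad , m = ≢⇒padded-mismatch u v (λ u≡v → bu≢b′v (cong (b ∷_) u≡v))
                 in pad , mismatch-∷ b m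
... | no b≢b′  = false , mismatch [] b (u ++ [ false ]) (v ++ [ false ]) refl
                           (cong (_∷ v ++ [ false ]) (¬-not (≢-sym b≢b′)))

differ⇒≢ : ∀ u v p x y c d pad → u ++ pad ≡ p ++ c ++ x → v ++ pad ≡ p ++ d ++ y →
  Conjugate (c ++ d ++ d ++ c) thueMorse₄ → u ≢ v
differ⇒≢ u v p x y c d pad eu ev conj with complementary-letters {c} {d} conj
... | b , refl , refl = λ u≡v → mismatch⇒≢ (mismatch p b x y eu ev) (cong (_++ pad) u≡v)

update-≡ : ∀ ρ v a → update ρ v a v ≡ a
update-≡ ρ v a with v ≟ v
... | yes _   = refl
... | no v≢v = contradiction refl v≢v

update-≢ : ∀ ρ {v w} a → w ≢ v → update ρ v a w ≡ ρ w
update-≢ ρ {v} {w} a w≢v with w ≟ v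
... | yes w≡v = contradiction w≡v w≢v
... | no _    = refl

update-cong : ∀ {ρ σ} v a → ρ ≗ σ → update ρ v a ≗ update σ v a
update-cong v a ρ≗σ w with w ≟ v
... | yes _ = refl
... | no _  = ρ≗σ w

varBound : Term → ℕ
varBound (var v) = suc v
varBound e       = 0
varBound c0      = 0
varBound c1      = 0
varBound (s ∘ t) = varBound s ⊔ varBound t

⟦⟧ₜ-local : ∀ u {ρ σ} → (∀ w → w < varBound u → ρ w ≡ σ w) → ⟦ u ⟧ₜ ρ ≡ ⟦ u ⟧ₜ σ
⟦⟧ₜ-local (var v) ρ≈σ = ρ≈σ v ≤-refl
⟦⟧ₜ-local e       _   = refl
⟦⟧ₜ-local c0      _   = refl
⟦⟧ₜ-local c1      _   = refl
⟦⟧ₜ-local (s ∘ t) ρ≈σ = cong₂ _++_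
  (⟦⟧ₜ-local s (λ w w<s → ρ≈σ w (<-≤-trans w<s (m≤m⊔n _ _))))
  (⟦⟧ₜ-local t (λ w w<t → ρ≈σ w (<-≤-trans w<t (m≤n⊔m _ _))))

≐-local : ∀ s t {ρ σ} → (∀ w → w < varBound s ⊔ varBound t → ρ w ≡ σ w) →
  ρ ⊨ (s ≐ t) → σ ⊨ (s ≐ t)
≐-local s t ρ≈σ eq = trans (sym (⟦⟧ₜ-local s (λ w w<s → ρ≈σ w (<-≤-trans w<s (m≤m⊔n _ _)))))
                     (trans eq (⟦⟧ₜ-local t (λ w w<t → ρ≈σ w (<-≤-trans w<t (m≤n⊔m _ _)))))

⊨-cong : ∀ φ {ρ σ} → ρ ≗ σ → ρ ⊨ φ → σ ⊨ φ
⊨-cong (s ≐ t)    ρ≗σ h = ≐-local s t (λ w _ → ρ≗σ w) h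
⊨-cong (s ⊑ᶠ t)   ρ≗σ h = subst₂ _⊑_ (⟦⟧ₜ-local s (λ w _ → ρ≗σ w)) (⟦⟧ₜ-local t (λ w _ → ρ≗σ w)) h
⊨-cong (¬ᶠ φ)     ρ≗σ h = λ σ⊨φ → h (⊨-cong φ (λ w → sym (ρ≗σ w)) σ⊨φ)
⊨-cong (φ ⇒ ψ)    ρ≗σ h = λ σ⊨φ → ⊨-cong ψ ρ≗σ (h (⊨-cong φ (λ w → sym (ρ≗σ w)) σ⊨φ))
⊨-cong (φ ⇔ ψ)    ρ≗σ (to , from) =
  (λ σ⊨φ → ⊨-cong ψ ρ≗σ (to (⊨-cong φ (λ w → sym (ρ≗σ w)) σ⊨φ))) ,
  (λ σ⊨ψ → ⊨-cong φ ρ≗σ (from (⊨-cong ψ (λ w → sym (ρ≗σ w)) σ⊨ψ)))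
⊨-cong (∀ᶠ v φ)   ρ≗σ h = λ a → ⊨-cong φ (update-cong v a ρ≗σ) (h a)
⊨-cong (∃ᶠ v φ)   ρ≗σ (a , h) = a , ⊨-cong φ (update-cong v a ρ≗σ) h

EqualOutside : List Var → Assignment → Assignment → Set
EqualOutside vs σ ρ = ∀ w → w ∉ vs → σ w ≡ ρ w

∃*-elim : ∀ vs φ {ρ} → ρ ⊨ ∃* vs φ → Σ Assignment λ σ → EqualOutside vs σ ρ × σ ⊨ φ
∃*-elim []       φ {ρ} h       = ρ , (λ _ _ → refl) , h
∃*-elim (v ∷ vs) φ {ρ} (a , h) with ∃*-elim vs φ h
... | σ , σ≈ , σ⊨φ =
  σ , (λ w w∉ → trans (σ≈ w (λ w∈ → w∉ (there w∈))) (update-≢ ρ a (λ w≡v → w∉ (here w≡v)))) , σ⊨φ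

∃*-intro : ∀ vs φ {ρ σ} → EqualOutside vs σ ρ → σ ⊨ φ → ρ ⊨ ∃* vs φ
∃*-intro []       φ         σ≈ σ⊨φ = ⊨-cong φ (λ w → σ≈ w λ ()) σ⊨φ
∃*-intro (v ∷ vs) φ {ρ} {σ} σ≈ σ⊨φ = σ v , ∃*-intro vs φ σ≈update σ⊨φ
  where
  σ≈update : EqualOutside vs σ (update ρ v (σ v))
  σ≈update w w∉ with w ≟ v
  ... | yes refl = refl
  ... | no w≢v   = σ≈ w λ { (here w≡v) → w≢v w≡v ; (there w∈) → w∉ w∈ }

override : List Var → Assignment → Assignment → Assignment
override vs τ ρ w with w ∈? vs
... | yes _ = τ w
... | no _  = ρ w

override-∈ : ∀ {vs τ ρ w} → w ∈ vs → override vs τ ρ w ≡ τ w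
override-∈ {vs} {w = w} w∈ with w ∈? vs
... | yes _  = refl
... | no w∉ = contradiction w∈ w∉

override-∉ : ∀ vs τ ρ → EqualOutside vs (override vs τ ρ) ρ
override-∉ vs _ _ w w∉ with w ∈? vs
... | yes w∈ = contradiction w∈ w∉
... | no _   = refl

_⟪_⟫ : Term → (Var → Term) → Term
var v   ⟪ θ ⟫ = θ v
e       ⟪ θ ⟫ = e
c0      ⟪ θ ⟫ = c0
c1      ⟪ θ ⟫ = c1
(s ∘ t) ⟪ θ ⟫ = (s ⟪ θ ⟫) ∘ (t ⟪ θ ⟫)

⟦⟧ₜ-subst : ∀ u θ ρ → ⟦ u ⟪ θ ⟫ ⟧ₜ ρ ≡ ⟦ u ⟧ₜ (λ v → ⟦ θ v ⟧ₜ ρ)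
⟦⟧ₜ-subst (var v) θ ρ = refl
⟦⟧ₜ-subst e       θ ρ = refl
⟦⟧ₜ-subst c0      θ ρ = refl
⟦⟧ₜ-subst c1      θ ρ = refl
⟦⟧ₜ-subst (s ∘ t) θ ρ = cong₂ _++_ (⟦⟧ₜ-subst s θ ρ) (⟦⟧ₜ-subst t θ ρ)

Equation : Set
Equation = Term × Term

⌜_⌝ : Equation → Formula
⌜ s , t ⌝ = s ≐ t

pairᵗ : Term → Term → Term
pairᵗ s t = s ∘ (c0 ∘ (t ∘ (s ∘ (c1 ∘ t))))

infixr 4 _∧ᵉ_
_∧ᵉ_ : Equation → Equation → Equation
(s , t) ∧ᵉ (s′ , t′) = pairᵗ s s′ , pairᵗ t t′

⊨-∧ᵉ : ∀ E E′ ρ → ρ ⊨ ⌜ E ∧ᵉ E′ ⌝ → ρ ⊨ ⌜ E ⌝ × ρ ⊨ ⌜ E′ ⌝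
⊨-∧ᵉ (s , t) (s′ , t′) ρ = pair-injective {⟦ s ⟧ₜ ρ} {⟦ s′ ⟧ₜ ρ} {⟦ t ⟧ₜ ρ} {⟦ t′ ⟧ₜ ρ}

-- Variables 0 and 1 hold the compared strings u and v; variables 2 … 9 hold p, x, y, c, d, pad, P, Q.
u-split v-split cddc-split rotated : Equation
u-split    = var 0 ∘ var 7 , var 2 ∘ (var 5 ∘ var 3)
v-split    = var 1 ∘ var 7 , var 2 ∘ (var 6 ∘ var 4)
cddc-split = var 5 ∘ (var 6 ∘ (var 6 ∘ var 5)) , var 8 ∘ var 9
rotated    = var 9 ∘ var 8 , c0 ∘ (c1 ∘ (c1 ∘ c0))

distinctᵉ : Equation
distinctᵉ = u-split ∧ᵉ v-split ∧ᵉ cddc-split ∧ᵉ rotated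

distinct⇒≢ : ∀ g → g ⊨ ⌜ distinctᵉ ⌝ → g 0 ≢ g 1
distinct⇒≢ g eq =
  let e₁ , eq′ = ⊨-∧ᵉ u-split (v-split ∧ᵉ cddc-split ∧ᵉ rotated) g eq
      e₂ , eq″ = ⊨-∧ᵉ v-split (cddc-split ∧ᵉ rotated) g eq′
      e₃ , e₄  = ⊨-∧ᵉ cddc-split rotated g eq″
  in differ⇒≢ (g 0) (g 1) (g 2) (g 3) (g 4) (g 5) (g 6) (g 7) e₁ e₂ (g 8 , g 9 , e₃ , sym e₄)

≢⇒distinct : ∀ {u v} → u ≢ v → Σ Assignment λ g → g 0 ≡ u × g 1 ≡ v × g ⊨ ⌜ distinctᵉ ⌝
≢⇒distinct {u} {v} u≢v with ≢⇒padded-mismatch u v u≢v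
... | pad , mismatch p b x y eu ev with letters-conjugate b
...   | P , Q , eP , eQ = g , refl , refl , cong₂ pair eu (cong₂ pair ev (cong₂ pair eP (sym eQ)))
  where
  g : Assignment
  g 0 = u
  g 1 = v
  g 2 = p
  g 3 = x
  g 4 = y
  g 5 = [ b ]
  g 6 = [ not b ]
  g 7 = [ pad ]
  g 8 = P
  g 9 = Q
  g _ = []

module NonSubstring (s₁ t₁ : Term) where

  v₁ : Var
  v₁ = varBound s₁ ⊔ varBound t₁

  auxiliary : List Var
  auxiliary = applyUpTo (λ j → suc (j + v₁)) 8

  θ : Var → Term
  θ zero    = s₁
  θ (suc k) = var (k + v₁)

  s t : Term
  s = proj₁ distinctᵉ ⟪ θ ⟫
  t = proj₂ distinctᵉ ⟪ θ ⟫

  matrix : Formula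
  matrix = s ≐ t

  slots : Assignment → Assignment
  slots σ v = ⟦ θ v ⟧ₜ σ

  matrix⇒distinct : ∀ {σ} → σ ⊨ matrix → slots σ ⊨ ⌜ distinctᵉ ⌝
  matrix⇒distinct {σ} eq = trans (sym (⟦⟧ₜ-subst (proj₁ distinctᵉ) θ σ)) (trans eq (⟦⟧ₜ-subst (proj₂ distinctᵉ) θ σ))

  distinct⇒matrix : ∀ {σ} → slots σ ⊨ ⌜ distinctᵉ ⌝ → σ ⊨ matrix
  distinct⇒matrix {σ} eq = trans (⟦⟧ₜ-subst (proj₁ distinctᵉ) θ σ) (trans eq (sym (⟦⟧ₜ-subst (proj₂ distinctᵉ) θ σ)))

  ≤v₁⇒∉auxiliary : ∀ {w} → w ≤ v₁ → w ∉ auxiliary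
  ≤v₁⇒∉auxiliary w≤v₁ w∈ with ∈-applyUpTo⁻ (λ j → suc (j + v₁)) w∈
  ... | j , _ , refl = <⇒≱ (s≤s (m≤n+m v₁ j)) w≤v₁

  t₁-unchanged : ∀ ρ a → ⟦ t₁ ⟧ₜ (update ρ v₁ a) ≡ ⟦ t₁ ⟧ₜ ρ
  t₁-unchanged ρ a = ⟦⟧ₜ-local t₁ λ w w<t₁ → update-≢ ρ a (<⇒≢ (<-≤-trans w<t₁ (m≤n⊔m _ _)))

  slots-unchanged : ∀ {ρ σ a} → EqualOutside auxiliary σ (update ρ v₁ a) →
    slots σ 0 ≡ ⟦ s₁ ⟧ₜ ρ × slots σ 1 ≡ a
  slots-unchanged {ρ} {σ} {a} σ≈ =
    ⟦⟧ₜ-local s₁ below-v₁ , trans (σ≈ v₁ (≤v₁⇒∉auxiliary ≤-refl)) (update-≡ ρ v₁ a)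
    where
    below-v₁ : ∀ w → w < varBound s₁ → σ w ≡ ρ w
    below-v₁ w w<s₁ = trans (σ≈ w (≤v₁⇒∉auxiliary (<⇒≤ w<v₁))) (update-≢ ρ a (<⇒≢ w<v₁))
      where
      w<v₁ : w < v₁
      w<v₁ = <-≤-trans w<s₁ (m≤m⊔n _ _)

  realise : ∀ ρ a g → g 0 ≡ ⟦ s₁ ⟧ₜ ρ → g 1 ≡ a → g ⊨ ⌜ distinctᵉ ⌝ →
    update ρ v₁ a ⊨ ∃* auxiliary matrix
  realise ρ a g g₀ g₁ g⊨ =
    ∃*-intro auxiliary matrix σ≈ (distinct⇒matrix (≐-local (proj₁ distinctᵉ) (proj₂ distinctᵉ) g≈slots g⊨))
    where
    σ : Assignment
    σ = override auxiliary (λ w → g (suc (w ∸ v₁))) (update ρ v₁ a)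
    σ≈ : EqualOutside auxiliary σ (update ρ v₁ a)
    σ≈ = override-∉ auxiliary _ _
    g≈slots : ∀ i → i < 10 → g i ≡ slots σ i
    g≈slots 0             _                 = trans g₀ (sym (proj₁ (slots-unchanged σ≈)))
    g≈slots 1             _                 = trans g₁ (sym (proj₂ (slots-unchanged σ≈)))
    g≈slots (suc (suc j)) (s≤s (s≤s j<8)) =
      sym (trans (override-∈ (∈-applyUpTo⁺ (λ j → suc (j + v₁)) j<8))
                 (cong (λ k → g (suc k)) (m+n∸n≡m (suc j) v₁)))

  sound : ∀ ρ → ρ ⊨ ∀⊑ v₁ t₁ (∃* auxiliary matrix) → ρ ⊨ (¬ᶠ (s₁ ⊑ᶠ t₁))
  sound ρ H s₁⊑t₁ =
    let σ , σ≈ , σ⊨ = ∃*-elim auxiliary matrix (H (⟦ s₁ ⟧ₜ ρ) v₁⊑t₁)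
        σ₀ , σ₁     = slots-unchanged σ≈
    in distinct⇒≢ (slots σ) (matrix⇒distinct σ⊨) (trans σ₀ (sym σ₁))
    where
    v₁⊑t₁ : update ρ v₁ (⟦ s₁ ⟧ₜ ρ) ⊨ (var v₁ ⊑ᶠ t₁)
    v₁⊑t₁ = subst₂ _⊑_ (sym (update-≡ ρ v₁ _)) (sym (t₁-unchanged ρ _)) s₁⊑t₁

  complete : ∀ ρ → ρ ⊨ (¬ᶠ (s₁ ⊑ᶠ t₁)) → ρ ⊨ ∀⊑ v₁ t₁ (∃* auxiliary matrix)
  complete ρ s₁⋢t₁ a v₁⊑t₁ =
    let g , g₀ , g₁ , g⊨ = ≢⇒distinct s₁≢a in realise ρ a g g₀ g₁ g⊨
    where
    s₁≢a : ⟦ s₁ ⟧ₜ ρ ≢ a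
    s₁≢a s₁≡a = s₁⋢t₁ (subst₂ _⊑_ (trans (update-≡ ρ v₁ a) (sym s₁≡a)) (t₁-unchanged ρ a) v₁⊑t₁)

lemma20 : (s₁ t₁ : Term) →
    Σ Term λ s → Σ Term λ t → Σ Var λ v₁ → Σ (List Var) λ vs →
      𝔅⊨ ((¬ᶠ (s₁ ⊑ᶠ t₁)) ⇔ ∀⊑ v₁ t₁ (∃* vs (s ≐ t)))
lemma20 s₁ t₁ = s , t , v₁ , auxiliary , λ ρ → complete ρ , sound ρ
  where open NonSubstring s₁ t₁
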